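{- Let $p>q>1$ be integers and let $\varphi$ be a CNF formula with variables $x_1,\ldots,x_n$ and clauses $C_1,\ldots,C_m$. If $\varphi$ has a satisfying assignment, then the $\operatorname{AUX}(p,q)$ instance constructed from $\varphi$ (as described in the context) is a yes-instance.
   Context: A task $([r,d],l)$ has integer release time $r$, integer deadline $d$ and positive integer processing time $l$; a feasible schedule assigns start times $t$ with $r\le t\le d-l$ for each task such that the intervals $[t,t+l)$ are pairwise disjoint. $\operatorname{AUX}(p,q)$ instance: a task set $J$ and integer deadline pairs $(d'_p[i],d_p[i]),(d'_q[i],d_q[i])$, $i=1,\ldots,N$; with pending tasks $J_p[i]=([0,d_p[i]],p)$, $J_q[i]=([0,d_q[i]],q)$, it is a yes-instance if there is a feasible schedule of $J\cup\{J_p[i]\}\cup\{J_q[i]\}$ such that for every $i$, $J_p[i]$ completes by $d'_p[i]$ or $J_q[i]$ completes by $d'_q[i]$. Blocks: a block consists of a set of auxiliary tasks (non-negative release times) and optionally a long pending pair $(d'_p,d_p)$ and/or a short pending pair $(d'_q,d_q)$; its length $L$ is the total processing time of its tasks (auxiliary and pending). From a sequence of blocks $F_1,\ldots,F_{|F|}$ and a set $I_{sep}$ of block indices, the instance is built as follows: $\operatorname{ofs}(F_1)=0$, $\operatorname{ofs}(F_i)=\operatorname{ofs}(F_{i-1})+L(F_{i-1})+q+1$ if $i-1\in I_{sep}$ and $\operatorname{ofs}(F_i)=\operatorname{ofs}(F_{i-1})+L(F_{i-1})$ otherwise; $J$ consists of separator tasks $([\operatorname{ofs}(F_i)+L(F_i)+1,\operatorname{ofs}(F_i)+L(F_i)+q+1],q)$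 for $i\in I_{sep}$ and of tasks $([r+\operatorname{ofs}(F_i),d+\operatorname{ofs}(F_i)],l)$ for each auxiliary task $([r,d],l)$ of each $F_i$; the $k$-th block (in order) defining a long pending pair $(d'_p,d_p)$ gives $d'_p[k]=d'_p+\operatorname{ofs}$, $d_p[k]=d_p+\operatorname{ofs}$ of that block, and likewise for short pending pairs. Block types: $V^+$ has long pending pair $(p+q+1,p+2q)$ and auxiliary tasks $([1,2q],q)$, $([0,p+2q+1],q)$; $V^-$ has short pending pair $(q,p+2q)$ and auxiliary tasks $([q+1,p+q],q)$, $([0,p+2q+1],p)$; $C_{active}$ has no auxiliary tasks and long and short pending pairs both equal to $(p+q,p+q+1)$; $C_{inactive}$ has no auxiliary tasks and long and short pending pairs both equal to $(p+q-1,p+q+1)$; a long dummy block has only a long pending pair $(p-1,p)$; a short dummy block has only a short pending pair $(q-1,q)$. Construction from $\varphi$: the block sequence is: $m$ long dummy blocks; then, for each literal $\ell$ in the order $x_1,\neg x_1,x_2,\neg x_2,\ldots,x_n,\neg x_n$, a literal block ($V^+$ if $\ell$ is positive, $V^-$ if negative) followed by $m$ clause blocks, the $j$-th of which is $C_{active}$ if $\ell\in C_j$ and $C_{inactive}$ otherwise, with the index of the last of these $m$ clause blocks put into $I_{sep}$ (a separator after each literal's sequence); finally $m$ short dummy blocks. The $\operatorname{AUX}(p,q)$ instance constructed from $\varphi$ is the one obtained from this block sequence and $I_{sep}$ (it has $N=n+m(2n+1)$ pending tasks of each length). -}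

module Defs where

open import Data.Nat using (ℕ; zero; suc; _+_; _*_; _∸_; _≤_)
open import Data.Nat.ListAction using (sum)
open import Data.Bool using (Bool; true; false; if_then_else_)
open import Data.Fin using (Fin; toℕ; cast)
open import Data.List using (List; []; _∷_; _++_; map; length; replicate; concatMap; lookup; allFin)
open import Data.Maybe using (Maybe; just; nothing)
open import Data.Product using (Σ; ∃; _×_; _,_; proj₁; proj₂)
open import Data.Sum using (_⊎_; inj₁; inj₂)
open import Data.List.Relation.Unary.Any using (Any)
open import Relation.Binary.PropositionalEquality using (_≡_; _≢_)
open import Relation.Nullary.Decidable using (⌊_⌋)
import Data.Product.Properties as ×P
import Data.Fin.Properties as FinP
import Data.Bool.Properties as BoolP
import Data.List.Membership.DecPropositional as DecMem

record Task : Set where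
  constructor task
  field
    release  : ℕ
    deadline : ℕ
    len      : ℕ
open Task public

Disjoint : ℕ → ℕ → ℕ → ℕ → Set
Disjoint t l t' l' = (t + l ≤ t') ⊎ (t' + l' ≤ t)

Feasible : {I : Set} → (I → Task) → (I → ℕ) → Set
Feasible {I} tsk t =
  (∀ i → (release (tsk i) ≤ t i) × (t i + len (tsk i) ≤ deadline (tsk i)))
  × (∀ i j → i ≢ j → Disjoint (t i) (len (tsk i)) (t j) (len (tsk j)))

-- An instance: task set J, long deadline pairs (d'_p[i], d_p[i]) and
-- short deadline pairs (d'_q[i], d_q[i]).
record AuxInstance : Set where
  constructor auxInstance
  field
    tasks      : List Task
    longPairs  : List (ℕ × ℕ)
    shortPairs : List (ℕ × ℕ)
open AuxInstance public

AllIdx : AuxInstance → Set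
AllIdx I = Fin (length (tasks I)) ⊎ (Fin (length (longPairs I)) ⊎ Fin (length (shortPairs I)))

allTask : ℕ → ℕ → (I : AuxInstance) → AllIdx I → Task
allTask p q I (inj₁ k) = lookup (tasks I) k
allTask p q I (inj₂ (inj₁ i)) = task 0 (proj₂ (lookup (longPairs I) i)) p
allTask p q I (inj₂ (inj₂ i)) = task 0 (proj₂ (lookup (shortPairs I) i)) q

YesInstance : ℕ → ℕ → AuxInstance → Set
YesInstance p q I =
  Σ (length (longPairs I) ≡ length (shortPairs I)) λ eq →
  Σ (AllIdx I → ℕ) λ t →
    Feasible (allTask p q I) t
    × (∀ (i : Fin (length (longPairs I))) →
         (t (inj₂ (inj₁ i)) + p ≤ proj₁ (lookup (longPairs I) i))
         ⊎ (t (inj₂ (inj₂ (cast eq i))) + q ≤ proj₁ (lookup (shortPairs I) (cast eq i))))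

record Block : Set where
  constructor block
  field
    aux       : List Task
    longPair  : Maybe (ℕ × ℕ)
    shortPair : Maybe (ℕ × ℕ)
open Block public

maybeLen : {A : Set} → ℕ → Maybe A → ℕ
maybeLen k (just _) = k
maybeLen k nothing  = 0

blockLen : ℕ → ℕ → Block → ℕ
blockLen p q F = sum (map len (aux F)) + maybeLen p (longPair F) + maybeLen q (shortPair F)

shiftTask : ℕ → Task → Task
shiftTask o (task r d l) = task (r + o) (d + o) l

shiftPair : ℕ → ℕ × ℕ → ℕ × ℕ
shiftPair o (d' , d) = (d' + o , d + o)

maybeList : {A : Set} → Maybe A → List A
maybeList (just x) = x ∷ []
maybeList nothing  = []

-- Build the instance from a sequence of blocks; each block carries a flag
-- telling whether its index belongs to I_sep.  The first argument is the
-- offset ofs of the first block of the list.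
buildFrom : ℕ → ℕ → ℕ → List (Block × Bool) → AuxInstance
buildFrom p q o [] = auxInstance [] [] []
buildFrom p q o ((F , sep) ∷ rest) =
  auxInstance
    (map (shiftTask o) (aux F) ++ sepTasks ++ tasks R)
    (map (shiftPair o) (maybeList (longPair F)) ++ longPairs R)
    (map (shiftPair o) (maybeList (shortPair F)) ++ shortPairs R)
  where
    L : ℕ
    L = blockLen p q F
    sepTasks : List Task
    sepTasks = if sep then task (o + L + 1) (o + L + q + 1) q ∷ [] else []
    R : AuxInstance
    R = buildFrom p q (o + L + (if sep then q + 1 else 0)) rest

build : ℕ → ℕ → List (Block × Bool) → AuxInstance
build p q = buildFrom p q 0

Vplus : ℕ → ℕ → Block
Vplus p q = block (task 1 (2 * q) q ∷ task 0 (p + 2 * q + 1) q ∷ [])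
                  (just (p + q + 1 , p + 2 * q)) nothing

Vminus : ℕ → ℕ → Block
Vminus p q = block (task (q + 1) (p + q) q ∷ task 0 (p + 2 * q + 1) p ∷ [])
                   nothing (just (q , p + 2 * q))

Cactive : ℕ → ℕ → Block
Cactive p q = block [] (just (p + q , p + q + 1)) (just (p + q , p + q + 1))

-- (p + q - 1 written as p + q ∸ 1; p + q ≥ 1 in our setting)
Cinactive : ℕ → ℕ → Block
Cinactive p q = block [] (just (p + q ∸ 1 , p + q + 1)) (just (p + q ∸ 1 , p + q + 1))

longDummy : ℕ → ℕ → Block
longDummy p q = block [] (just (p ∸ 1 , p)) nothing

shortDummy : ℕ → ℕ → Block
shortDummy p q = block [] nothing (just (q ∸ 1 , q))

-- A literal over variables x_1..x_n: (variable, polarity); polarity true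
-- means the positive literal x_i, false means ¬x_i.
Literal : ℕ → Set
Literal n = Fin n × Bool

_≟L_ : {n : ℕ} → (a b : Literal n) → _
_≟L_ = ×P.≡-dec FinP._≟_ BoolP._≟_

Clause : ℕ → Set
Clause n = List (Literal n)

CNF : ℕ → ℕ → Set
CNF n m = Fin m → Clause n

SatLit : {n : ℕ} → (Fin n → Bool) → Literal n → Set
SatLit a (i , b) = a i ≡ b

Satisfies : {n m : ℕ} → (Fin n → Bool) → CNF n m → Set
Satisfies {m = m} a φ = ∀ (j : Fin m) → Any (SatLit a) (φ j)

Satisfiable : {n m : ℕ} → CNF n m → Set
Satisfiable {n} φ = ∃ λ (a : Fin n → Bool) → Satisfies a φ

-- flag the last element of a list (it goes into I_sep)
markLast : List Block → List (Block × Bool)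
markLast [] = []
markLast (F ∷ []) = (F , true) ∷ []
markLast (F ∷ G ∷ Fs) = (F , false) ∷ markLast (G ∷ Fs)

literalBlock : ℕ → ℕ → Bool → Block
literalBlock p q true  = Vplus p q
literalBlock p q false = Vminus p q

clauseBlock : ∀ {n m} → ℕ → ℕ → CNF n m → Literal n → Fin m → Block
clauseBlock {n} p q φ ℓ j =
  if ⌊ ℓ ∈? φ j ⌋ then Cactive p q else Cinactive p q
  where open DecMem (_≟L_ {n}) using (_∈?_)

literalSeq : ∀ {n m} → ℕ → ℕ → CNF n m → Literal n → List (Block × Bool)
literalSeq {m = m} p q φ ℓ =
  markLast (literalBlock p q (proj₂ ℓ) ∷ map (clauseBlock p q φ ℓ) (allFin m))

blockSequence : ∀ {n m} → ℕ → ℕ → CNF n m → List (Block × Bool)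
blockSequence {n} {m} p q φ =
  replicate m (longDummy p q , false)
  ++ concatMap (λ i → literalSeq p q φ (i , true) ++ literalSeq p q φ (i , false)) (allFin n)
  ++ replicate m (shortDummy p q , false)

constructAux : ∀ {n m} → ℕ → ℕ → CNF n m → AuxInstance
constructAux p q φ = build p q (blockSequence p q φ)

module Submission where

-- Each block, at offset o and of length L, is scheduled inside
-- [o, o+L] ("on time") or inside [o+1, o+L+1] ("late"); a late block forces
-- the next one to be late, and the separator after each literal sequence
-- absorbs the delay.  For a satisfying assignment α the blocks of a literal
-- ℓ are late exactly when α falsifies ℓ, and the clause block of C_j in the
-- sequence of ℓ runs its long pending task first iff C_j is satisfied by ℓ
-- or by an earlier literal.  Recording by a flag whether each pending task
-- meets its first deadline, the i-th long or the i-th short flag is always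
-- set, which is the yes-condition.

open import Defs
open import Data.Nat using (ℕ; zero; suc; _+_; _*_; _∸_; _≤_; _<_; z≤n; s≤s)
open import Data.Nat.Properties
open import Data.Nat.Tactic.RingSolver using (solve)
open import Data.Bool as Bool using (Bool; true; false; not; _∧_; _∨_; if_then_else_; f≤t; b≤b)
open import Data.Bool.Properties using (∨-zeroʳ; ∨-identityʳ; ∨-inverseˡ; ≤-minimum)
open import Data.Fin using (Fin; toℕ; cast) renaming (zero to fzero; suc to fsuc)
open import Data.Fin.Properties using (toℕ<n; toℕ-cast)
open import Data.List
  using (List; []; _∷_; _++_; length; lookup; map; replicate; concatMap; allFin; foldl)
open import Data.List.Properties using (length-++; ++-assoc; ++-identityʳ; length-tabulate)
open import Data.List.Relation.Unary.Any using (here; there)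
open import Data.List.Membership.Propositional using (_∈_; find)
open import Data.List.Membership.Propositional.Properties using (∈-allFin)
open import Data.List.Relation.Binary.Pointwise as Pointwise using (Pointwise; []; _∷_)
open import Data.Maybe using (just)
open import Data.Product using (Σ-syntax; _×_; _,_; proj₁; proj₂)
open import Data.Sum as Sum using (_⊎_; inj₁; inj₂; [_,_]′)
open import Data.Sum.Properties using ([,]-map; [,]-∘)
open import Data.Empty using (⊥-elim)
open import Function using (_∘_; id)
open import Relation.Nullary.Decidable using (⌊_⌋; yes; no)
open import Relation.Binary.PropositionalEquality
import Data.List.Membership.DecPropositional as DecMembership

module _ {A : Set} where

  splitIndex : (xs ys : List A) → Fin (length (xs ++ ys)) → Fin (length xs) ⊎ Fin (length ys)
  splitIndex []       ys k        = inj₂ k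
  splitIndex (x ∷ xs) ys fzero    = inj₁ fzero
  splitIndex (x ∷ xs) ys (fsuc k) = Sum.map₁ fsuc (splitIndex xs ys k)

  joinIndex : (xs ys : List A) → Fin (length xs) ⊎ Fin (length ys) → Fin (length (xs ++ ys))
  joinIndex []       ys (inj₂ k)        = k
  joinIndex (x ∷ xs) ys (inj₁ fzero)    = fzero
  joinIndex (x ∷ xs) ys (inj₁ (fsuc k)) = fsuc (joinIndex xs ys (inj₁ k))
  joinIndex (x ∷ xs) ys (inj₂ k)        = fsuc (joinIndex xs ys (inj₂ k))

  join-split : ∀ xs ys k → joinIndex xs ys (splitIndex xs ys k) ≡ k
  join-split []       ys k        = refl
  join-split (x ∷ xs) ys fzero    = refl
  join-split (x ∷ xs) ys (fsuc k) with splitIndex xs ys k | join-split xs ys k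
  ... | inj₁ _ | eq = cong fsuc eq
  ... | inj₂ _ | eq = cong fsuc eq

  lookup-split : ∀ xs ys k →
                 lookup (xs ++ ys) k ≡ [ lookup xs , lookup ys ]′ (splitIndex xs ys k)
  lookup-split []       ys k        = refl
  lookup-split (x ∷ xs) ys fzero    = refl
  lookup-split (x ∷ xs) ys (fsuc k) with splitIndex xs ys k | lookup-split xs ys k
  ... | inj₁ _ | eq = eq
  ... | inj₂ _ | eq = eq

  toℕ-split : ∀ xs ys k →
              toℕ k ≡ [ toℕ , (λ j → length xs + toℕ j) ]′ (splitIndex xs ys k)
  toℕ-split []       ys k        = refl
  toℕ-split (x ∷ xs) ys fzero    = refl
  toℕ-split (x ∷ xs) ys (fsuc k) with splitIndex xs ys k | toℕ-split xs ys k
  ... | inj₁ _ | eq = cong suc eq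
  ... | inj₂ _ | eq = cong suc eq

[,]-all : {A B : Set} {f : A → ℕ} {g : B → ℕ} (P : ℕ → Set) →
          (∀ a → P (f a)) → (∀ b → P (g b)) → ∀ x → P ([ f , g ]′ x)
[,]-all P Pf Pg (inj₁ a) = Pf a
[,]-all P Pf Pg (inj₂ b) = Pg b

flagAt : List Bool → ℕ → Bool
flagAt []       k       = false
flagAt (b ∷ bs) zero    = b
flagAt (b ∷ bs) (suc k) = flagAt bs k

flagAt-++ˡ : ∀ bs cs k → k < length bs → flagAt (bs ++ cs) k ≡ flagAt bs k
flagAt-++ˡ (b ∷ bs) cs zero    _         = refl
flagAt-++ˡ (b ∷ bs) cs (suc k) (s≤s k<) = flagAt-++ˡ bs cs k k<

flagAt-++ʳ : ∀ bs cs k → flagAt (bs ++ cs) (length bs + k) ≡ flagAt cs k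
flagAt-++ʳ []       cs k = refl
flagAt-++ʳ (b ∷ bs) cs k = flagAt-++ʳ bs cs k

flagAt-pointwise : ∀ {R : Bool → Bool → Set} {bs cs} → Pointwise R bs cs →
                   ∀ k → k < length bs → R (flagAt bs k) (flagAt cs k)
flagAt-pointwise (r ∷ rs) zero    _         = r
flagAt-pointwise (r ∷ rs) (suc k) (s≤s k<) = flagAt-pointwise rs k k<

Met : (pairs : List (ℕ × ℕ)) → (Fin (length pairs) → ℕ) → List Bool → Set
Met pairs finish flags =
  ∀ i → flagAt flags (toℕ i) ≡ true → finish i ≤ proj₁ (lookup pairs i)

Met-++ : ∀ xs ys {fl fl′} {f₁ : Fin (length xs) → ℕ} {f₂ : Fin (length ys) → ℕ}
         (f : Fin (length (xs ++ ys)) → ℕ) →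
         (∀ k → f k ≡ [ f₁ , f₂ ]′ (splitIndex xs ys k)) → length fl ≡ length xs →
         Met xs f₁ fl → Met ys f₂ fl′ → Met (xs ++ ys) f (fl ++ fl′)
Met-++ xs ys {fl} {fl′} f f-split fl-length met₁ met₂ k flag
  rewrite f-split k
  with splitIndex xs ys k | lookup-split xs ys k | toℕ-split xs ys k
... | inj₁ a | lookup≡ | toℕ≡ rewrite lookup≡ =
  met₁ a (trans (sym (flagAt-++ˡ fl fl′ (toℕ a) (subst (toℕ a <_) (sym fl-length) (toℕ<n a))))
                (subst (λ k → flagAt (fl ++ fl′) k ≡ true) toℕ≡ flag))
... | inj₂ b | lookup≡ | toℕ≡ rewrite lookup≡ =
  met₂ b (trans (sym (flagAt-++ʳ fl fl′ (toℕ b)))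
                (subst (λ k → flagAt (fl ++ fl′) k ≡ true)
                       (trans toℕ≡ (cong (_+ toℕ b) (sym fl-length))) flag))

Placed : Task → ℕ → Set
Placed τ t = release τ ≤ t × t + len τ ≤ deadline τ

Feasible-⊎ : {A B : Set} {τ₁ : A → Task} {τ₂ : B → Task} {t₁ : A → ℕ} {t₂ : B → ℕ}
             (m : ℕ) →
             Feasible τ₁ t₁ → Feasible τ₂ t₂ →
             (∀ a → t₁ a + len (τ₁ a) ≤ m) → (∀ b → m ≤ t₂ b) →
             Feasible [ τ₁ , τ₂ ]′ [ t₁ , t₂ ]′
Feasible-⊎ {A} {B} {τ₁} {τ₂} {t₁} {t₂} m (placed₁ , disjoint₁) (placed₂ , disjoint₂)
           ends starts = placed , disjoint
  where
  τ : A ⊎ B → Task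
  τ = [ τ₁ , τ₂ ]′
  t : A ⊎ B → ℕ
  t = [ t₁ , t₂ ]′
  placed : ∀ i → Placed (τ i) (t i)
  placed (inj₁ a) = placed₁ a
  placed (inj₂ b) = placed₂ b
  disjoint : ∀ i j → i ≢ j → Disjoint (t i) (len (τ i)) (t j) (len (τ j))
  disjoint (inj₁ a) (inj₁ a′) ne = disjoint₁ a a′ (λ eq → ne (cong inj₁ eq))
  disjoint (inj₁ a) (inj₂ b)  _  = inj₁ (≤-trans (ends a) (starts b))
  disjoint (inj₂ b) (inj₁ a)  _  = inj₂ (≤-trans (ends a) (starts b))
  disjoint (inj₂ b) (inj₂ b′) ne = disjoint₂ b b′ (λ eq → ne (cong inj₂ eq))

Feasible-reindex : {X Y : Set} {τ : X → Task} {σ : Y → Task} {t : X → ℕ} (g : Y → X) →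
                   (∀ y y′ → g y ≡ g y′ → y ≡ y′) → (∀ y → σ y ≡ τ (g y)) →
                   Feasible τ t → Feasible σ (λ y → t (g y))
Feasible-reindex {τ = τ} {σ} {t} g g-injective same (placed , disjoint) =
  (λ y → subst (λ τ′ → Placed τ′ (t (g y))) (sym (same y)) (placed (g y))) ,
  (λ y y′ ne → subst₂ (λ τ′ τ″ → Disjoint (t (g y)) (len τ′) (t (g y′)) (len τ″))
                      (sym (same y)) (sym (same y′))
                      (disjoint (g y) (g y′) (λ eq → ne (g-injective y y′ eq))))

module _ {X : Set} (start size : X → ℕ) where

  data Runs : ℕ → ℕ → List X → Set where
    done : ∀ {lo hi} → lo ≤ hi → Runs lo hi []
    _▸_  : ∀ {lo hi x xs} → lo ≤ start x → Runs (start x + size x) hi xs →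
           Runs lo hi (x ∷ xs)

  infixr 5 _▸_

  runs-bounded : ∀ {lo hi xs} → Runs lo hi xs → lo ≤ hi
  runs-bounded (done lo≤hi)     = lo≤hi
  runs-bounded (lo≤x ▸ rest)    = ≤-trans lo≤x (≤-trans (m≤m+n _ _) (runs-bounded rest))

  runs-window : ∀ {lo hi xs x} → Runs lo hi xs → x ∈ xs →
                lo ≤ start x × start x + size x ≤ hi
  runs-window (lo≤x ▸ rest) (here refl) = lo≤x , runs-bounded rest
  runs-window (lo≤y ▸ rest) (there x∈) with runs-window rest x∈
  ... | y-before-x , x-ends = ≤-trans lo≤y (≤-trans (m≤m+n _ _) y-before-x) , x-ends

  runs-disjoint : ∀ {lo hi xs x y} → Runs lo hi xs → x ∈ xs → y ∈ xs → x ≢ y →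
                  Disjoint (start x) (size x) (start y) (size y)
  runs-disjoint (_ ▸ rest) (here refl) (here refl) ne = ⊥-elim (ne refl)
  runs-disjoint (_ ▸ rest) (here refl) (there y∈)  _  = inj₁ (proj₁ (runs-window rest y∈))
  runs-disjoint (_ ▸ rest) (there x∈)  (here refl) _  = inj₂ (proj₁ (runs-window rest x∈))
  runs-disjoint (_ ▸ rest) (there x∈)  (there y∈)  ne = runs-disjoint rest x∈ y∈ ne

atOffset : ∀ o d l δ → δ + l ≤ d → o + δ + l ≤ d + o
atOffset o d l δ h =
  ≤-trans (≤-reflexive (trans (+-assoc o δ l) (+-comm o (δ + l)))) (+-monoˡ-≤ o h)

placedAux : ∀ o r d l δ → r ≤ δ → δ + l ≤ d → Placed (task (r + o) (d + o) l) (o + δ)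
placedAux o r d l δ r≤δ fits =
  ≤-trans (≤-reflexive (+-comm r o)) (+-monoʳ-≤ o r≤δ) , atOffset o d l δ fits

placedPending : ∀ o d l δ → δ + l ≤ d → Placed (task 0 (d + o) l) (o + δ)
placedPending o d l δ fits = z≤n , atOffset o d l δ fits

-- Linear arithmetic by an explicit slack k (the equation is typically
-- checked by the ring solver).
slack : ∀ {x y} k → x + k ≡ y → x ≤ y
slack {x} k refl = m≤m+n x k

-- Delays: a block scheduled late is shifted by one time unit

delay : Bool → ℕ → ℕ
delay false n = n
delay true  n = suc n

≤-delay : ∀ b n → n ≤ delay b n
≤-delay false n = ≤-refl
≤-delay true  n = n≤1+n n

delay-≤ : ∀ b n → delay b n ≤ n + 1
delay-≤ false n = m≤m+n n 1
delay-≤ true  n = ≤-reflexive (+-comm 1 n)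

delay-mono : ∀ {b b′} n → b Bool.≤ b′ → delay b n ≤ delay b′ n
delay-mono n f≤t = n≤1+n n
delay-mono n b≤b = ≤-refl

delay-+ : ∀ b o n → delay b (o + n) ≡ o + delay b n
delay-+ false o n = refl
delay-+ true  o n = sym (+-suc o n)

delay-start : ∀ b x → delay b 0 + x ≡ delay b x
delay-start false x = refl
delay-start true  x = refl

delay-start-≤ : ∀ b x → delay b 0 + x ≤ x + 1
delay-start-≤ b x = ≤-trans (≤-reflexive (delay-start b x)) (delay-≤ b x)

shift-lower : ∀ b o {δ} → delay b 0 ≤ δ → delay b o ≤ o + δ
shift-lower false o _   = m≤m+n o _
shift-lower true  o 1≤δ = ≤-trans (≤-reflexive (+-comm 1 o)) (+-monoʳ-≤ o 1≤δ)

shift-≤ : ∀ o {δ l x} → δ + l ≤ x → o + δ + l ≤ o + x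
shift-≤ o {δ} {l} h = ≤-trans (≤-reflexive (+-assoc o δ l)) (+-monoʳ-≤ o h)

_⊕_ : AuxInstance → AuxInstance → AuxInstance
I ⊕ J = auxInstance (tasks I ++ tasks J) (longPairs I ++ longPairs J) (shortPairs I ++ shortPairs J)

splitIdx : ∀ I J → AllIdx (I ⊕ J) → AllIdx I ⊎ AllIdx J
splitIdx I J (inj₁ k)        = Sum.map inj₁ inj₁ (splitIndex (tasks I) (tasks J) k)
splitIdx I J (inj₂ (inj₁ k)) =
  Sum.map (inj₂ ∘ inj₁) (inj₂ ∘ inj₁) (splitIndex (longPairs I) (longPairs J) k)
splitIdx I J (inj₂ (inj₂ k)) =
  Sum.map (inj₂ ∘ inj₂) (inj₂ ∘ inj₂) (splitIndex (shortPairs I) (shortPairs J) k)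

joinIdx : ∀ I J → AllIdx I ⊎ AllIdx J → AllIdx (I ⊕ J)
joinIdx I J (inj₁ (inj₁ k))        = inj₁ (joinIndex (tasks I) (tasks J) (inj₁ k))
joinIdx I J (inj₁ (inj₂ (inj₁ k))) = inj₂ (inj₁ (joinIndex (longPairs I) (longPairs J) (inj₁ k)))
joinIdx I J (inj₁ (inj₂ (inj₂ k))) = inj₂ (inj₂ (joinIndex (shortPairs I) (shortPairs J) (inj₁ k)))
joinIdx I J (inj₂ (inj₁ k))        = inj₁ (joinIndex (tasks I) (tasks J) (inj₂ k))
joinIdx I J (inj₂ (inj₂ (inj₁ k))) = inj₂ (inj₁ (joinIndex (longPairs I) (longPairs J) (inj₂ k)))
joinIdx I J (inj₂ (inj₂ (inj₂ k))) = inj₂ (inj₂ (joinIndex (shortPairs I) (shortPairs J) (inj₂ k)))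

join-splitIdx : ∀ I J i → joinIdx I J (splitIdx I J i) ≡ i
join-splitIdx I J (inj₁ k) with splitIndex (tasks I) (tasks J) k | join-split (tasks I) (tasks J) k
... | inj₁ _ | eq = cong inj₁ eq
... | inj₂ _ | eq = cong inj₁ eq
join-splitIdx I J (inj₂ (inj₁ k))
  with splitIndex (longPairs I) (longPairs J) k | join-split (longPairs I) (longPairs J) k
... | inj₁ _ | eq = cong (inj₂ ∘ inj₁) eq
... | inj₂ _ | eq = cong (inj₂ ∘ inj₁) eq
join-splitIdx I J (inj₂ (inj₂ k))
  with splitIndex (shortPairs I) (shortPairs J) k | join-split (shortPairs I) (shortPairs J) k
... | inj₁ _ | eq = cong (inj₂ ∘ inj₂) eq
... | inj₂ _ | eq = cong (inj₂ ∘ inj₂) eq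

splitIdx-injective : ∀ I J i j → splitIdx I J i ≡ splitIdx I J j → i ≡ j
splitIdx-injective I J i j eq =
  trans (sym (join-splitIdx I J i)) (trans (cong (joinIdx I J) eq) (join-splitIdx I J j))

allTask-⊕ : ∀ p q I J i →
            allTask p q (I ⊕ J) i ≡ [ allTask p q I , allTask p q J ]′ (splitIdx I J i)
allTask-⊕ p q I J (inj₁ k) =
  trans (lookup-split (tasks I) (tasks J) k) (sym ([,]-map (splitIndex (tasks I) (tasks J) k)))
allTask-⊕ p q I J (inj₂ (inj₁ k)) =
  trans (cong pending (lookup-split (longPairs I) (longPairs J) k))
        (trans ([,]-∘ pending (splitIndex (longPairs I) (longPairs J) k))
               (sym ([,]-map (splitIndex (longPairs I) (longPairs J) k))))
  where pending = λ (pair : ℕ × ℕ) → task 0 (proj₂ pair) p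
allTask-⊕ p q I J (inj₂ (inj₂ k)) =
  trans (cong pending (lookup-split (shortPairs I) (shortPairs J) k))
        (trans ([,]-∘ pending (splitIndex (shortPairs I) (shortPairs J) k))
               (sym ([,]-map (splitIndex (shortPairs I) (shortPairs J) k))))
  where pending = λ (pair : ℕ × ℕ) → task 0 (proj₂ pair) q

Covers : Bool → Bool → Set
Covers x y = x ∨ y ≡ true

Covers-cases : ∀ x y → Covers x y → x ≡ true ⊎ y ≡ true
Covers-cases true  y _      = inj₁ refl
Covers-cases false y y≡true = inj₂ y≡true

pattern auxA   = inj₁ fzero
pattern auxB   = inj₁ (fsuc fzero)
pattern longP  = inj₂ (inj₁ fzero)
pattern shortP = inj₂ (inj₂ fzero)

tasks-L : {P : Fin 0 ⊎ (Fin 1 ⊎ Fin 0) → Set} → P longP → ∀ i → P i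
tasks-L x longP = x
tasks-L x (inj₂ (inj₁ (fsuc ())))
tasks-L x (inj₂ (inj₂ ()))

tasks-S : {P : Fin 0 ⊎ (Fin 0 ⊎ Fin 1) → Set} → P shortP → ∀ i → P i
tasks-S x shortP = x
tasks-S x (inj₂ (inj₁ ()))
tasks-S x (inj₂ (inj₂ (fsuc ())))

tasks-V⁺ : {P : Fin 2 ⊎ (Fin 1 ⊎ Fin 0) → Set} → P auxA → P auxB → P longP → ∀ i → P i
tasks-V⁺ x y z auxA  = x
tasks-V⁺ x y z auxB  = y
tasks-V⁺ x y z longP = z
tasks-V⁺ x y z (inj₁ (fsuc (fsuc ())))
tasks-V⁺ x y z (inj₂ (inj₁ (fsuc ())))
tasks-V⁺ x y z (inj₂ (inj₂ ()))

tasks-V⁻ : {P : Fin 2 ⊎ (Fin 0 ⊎ Fin 1) → Set} → P auxA → P auxB → P shortP → ∀ i → P i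
tasks-V⁻ x y z auxA   = x
tasks-V⁻ x y z auxB   = y
tasks-V⁻ x y z shortP = z
tasks-V⁻ x y z (inj₁ (fsuc (fsuc ())))
tasks-V⁻ x y z (inj₂ (inj₁ ()))
tasks-V⁻ x y z (inj₂ (inj₂ (fsuc ())))

tasks-sep : {P : Fin 1 ⊎ (Fin 0 ⊎ Fin 0) → Set} → P auxA → ∀ i → P i
tasks-sep x auxA = x
tasks-sep x (inj₁ (fsuc ()))
tasks-sep x (inj₂ (inj₁ ()))
tasks-sep x (inj₂ (inj₂ ()))

tasks-C : {P : Fin 0 ⊎ (Fin 1 ⊎ Fin 1) → Set} → P longP → P shortP → ∀ i → P i
tasks-C x y longP  = x
tasks-C x y shortP = y
tasks-C x y (inj₂ (inj₁ (fsuc ())))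
tasks-C x y (inj₂ (inj₂ (fsuc ())))

module Scheduling (p q : ℕ) where

  LongMet : (I : AuxInstance) → (AllIdx I → ℕ) → List Bool → Set
  LongMet I t = Met (longPairs I) (λ i → t (inj₂ (inj₁ i)) + p)

  ShortMet : (I : AuxInstance) → (AllIdx I → ℕ) → List Bool → Set
  ShortMet I t = Met (shortPairs I) (λ i → t (inj₂ (inj₂ i)) + q)

  record Scheduled (I : AuxInstance) (fl fs : List Bool) : Set where
    field
      start      : AllIdx I → ℕ
      feasible   : Feasible (allTask p q I) start
      longCount  : length fl ≡ length (longPairs I)
      shortCount : length fs ≡ length (shortPairs I)
      longMet    : LongMet I start fl
      shortMet   : ShortMet I start fs
  open Scheduled

  StartsAfter : ∀ {I fl fs} → Scheduled I fl fs → ℕ → Set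
  StartsAfter S lo = ∀ i → lo ≤ start S i

  EndsBy : ∀ {I fl fs} → Scheduled I fl fs → ℕ → Set
  EndsBy {I} S hi = ∀ i → start S i + len (allTask p q I i) ≤ hi

  append : ∀ {I J fl fs fl′ fs′} (S : Scheduled I fl fs) (T : Scheduled J fl′ fs′)
           (m : ℕ) →
           EndsBy S m → StartsAfter T m → Scheduled (I ⊕ J) (fl ++ fl′) (fs ++ fs′)
  append {I} {J} {fl} {fs} {fl′} {fs′} S T m S-ends T-starts = record
    { start      = λ i → [ start S , start T ]′ (splitIdx I J i)
    ; feasible   = Feasible-reindex (splitIdx I J) (splitIdx-injective I J) (allTask-⊕ p q I J)
                     (Feasible-⊎ m (feasible S) (feasible T) S-ends T-starts)
    ; longCount  = counts fl (longPairs I) (longCount S) (longCount T)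
    ; shortCount = counts fs (shortPairs I) (shortCount S) (shortCount T)
    ; longMet    = Met-++ (longPairs I) (longPairs J) {fl} {fl′} _
                     (λ k → finish-split p (splitIndex (longPairs I) (longPairs J) k))
                     (longCount S) (longMet S) (longMet T)
    ; shortMet   = Met-++ (shortPairs I) (shortPairs J) {fs} {fs′} _
                     (λ k → finish-split q (splitIndex (shortPairs I) (shortPairs J) k))
                     (shortCount S) (shortMet S) (shortMet T)
    }
    where
    counts : ∀ {A : Set} (bs : List Bool) (xs : List A) {cs : List Bool} {ys : List A} →
             length bs ≡ length xs → length cs ≡ length ys →
             length (bs ++ cs) ≡ length (xs ++ ys)
    counts bs xs {cs} {ys} eq eq′ =
      trans (length-++ bs) (trans (cong₂ _+_ eq eq′) (sym (length-++ xs)))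
    finish-split : ∀ {C D : Set} {f : C → AllIdx I} {g : D → AllIdx J} (l : ℕ) (z : C ⊎ D) →
                   [ start S , start T ]′ (Sum.map f g z) + l
                   ≡ [ (λ c → start S (f c) + l) , (λ d → start T (g d) + l) ]′ z
    finish-split l z = trans (cong (_+ l) ([,]-map z)) ([,]-∘ (_+ l) z)

  append-startsAfter : ∀ {I J fl fs fl′ fs′ lo}
                       (S : Scheduled I fl fs) (T : Scheduled J fl′ fs′) →
                       StartsAfter S lo → StartsAfter T lo →
                       ∀ i → lo ≤ [ start S , start T ]′ (splitIdx I J i)
  append-startsAfter {I} {J} {lo = lo} S T S-after T-after i =
    [,]-all (lo ≤_) S-after T-after (splitIdx I J i)

  yes-instance : ∀ {I fl fs} → Scheduled I fl fs → Pointwise Covers fl fs → YesInstance p q I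
  yes-instance {I} {fl} {fs} S covers = counts , start S , feasible S , met
    where
    counts : length (longPairs I) ≡ length (shortPairs I)
    counts = trans (sym (longCount S)) (trans (Pointwise.Pointwise-length covers) (shortCount S))
    met : ∀ i → start S (inj₂ (inj₁ i)) + p ≤ proj₁ (lookup (longPairs I) i)
                ⊎ start S (inj₂ (inj₂ (cast counts i))) + q
                  ≤ proj₁ (lookup (shortPairs I) (cast counts i))
    met i with Covers-cases _ _ (flagAt-pointwise covers (toℕ i)
                                   (subst (toℕ i <_) (sym (longCount S)) (toℕ<n i)))
    ... | inj₁ long-flag  = inj₁ (longMet S i long-flag)
    ... | inj₂ short-flag = inj₂ (shortMet S (cast counts i)
                              (subst (λ k → flagAt fs k ≡ true)
                                     (sym (toℕ-cast counts i)) short-flag))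

  Empty : AuxInstance
  Empty = auxInstance [] [] []

  no-index : {P : AllIdx Empty → Set} → ∀ i → P i
  no-index (inj₁ ())
  no-index (inj₂ (inj₁ ()))
  no-index (inj₂ (inj₂ ()))

  nothing-scheduled : Scheduled Empty [] []
  nothing-scheduled = record
    { start = no-index ; feasible = no-index , no-index
    ; longCount = refl ; shortCount = refl ; longMet = λ () ; shortMet = λ () }

  -- The tasks of block F at offset o, and the optional separator task after
  -- a block ending at time x; these are the first two parts of buildFrom.
  blockAt : ℕ → Block → AuxInstance
  blockAt o F = auxInstance (map (shiftTask o) (aux F))
                            (map (shiftPair o) (maybeList (longPair F)))
                            (map (shiftPair o) (maybeList (shortPair F)))

  separatorAt : ℕ → Bool → AuxInstance
  separatorAt x sep = auxInstance (if sep then task (x + 1) (x + q + 1) q ∷ [] else []) [] []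

  gap : Bool → ℕ
  gap sep = if sep then q + 1 else 0

  separator : ∀ x sep → Σ[ S ∈ Scheduled (separatorAt x sep) [] [] ]
                          (StartsAfter S (x + 1) × EndsBy S (x + gap sep))
  separator x false = nothing-scheduled , no-index , no-index
  separator x true  = S , (λ _ → ≤-refl) , tasks-sep within
    where
    within : x + 1 + q ≤ x + (q + 1)
    within = ≤-reflexive (trans (+-assoc x 1 q) (cong (x +_) (+-comm 1 q)))
    fits : x + 1 + q ≤ x + q + 1
    fits = ≤-trans within (≤-reflexive (sym (+-assoc x q 1)))
    one-task : ∀ i j → i ≡ j
    one-task i j = tasks-sep {λ i → i ≡ j} (tasks-sep {λ j → auxA ≡ j} refl j) i
    S : Scheduled (separatorAt x true) [] []
    S = record
      { start = λ _ → x + 1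
      ; feasible = tasks-sep (≤-refl , fits) , λ i j i≢j → ⊥-elim (i≢j (one-task i j))
      ; longCount = refl ; shortCount = refl ; longMet = λ () ; shortMet = λ () }

  record LocalSchedule (o : ℕ) (F : Block) (s e : Bool) (fl fs : List Bool) : Set where
    field
      schedule : Scheduled (blockAt o F) fl fs
      window   : delay s o ≤ delay e (o + blockLen p q F)
      starts   : StartsAfter schedule (delay s o)
      ends     : EndsBy schedule (delay e (o + blockLen p q F))

  -- A local schedule described relative to the offset o: the tasks run in
  -- the given order inside [delay s 0, delay e L], where L is the block
  -- length written in a convenient form.
  record Layout (o : ℕ) (F : Block) (s e : Bool) (fl fs : List Bool) : Set where
    field
      L          : ℕ
      length≡L   : blockLen p q F ≡ L
      offset     : AllIdx (blockAt o F) → ℕ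
      order      : List (AllIdx (blockAt o F))
      complete   : ∀ i → i ∈ order
      runs       : Runs offset (len ∘ allTask p q (blockAt o F)) (delay s 0) (delay e L) order
      placed     : ∀ i → Placed (allTask p q (blockAt o F) i) (o + offset i)
      longCount  : length fl ≡ length (longPairs (blockAt o F))
      shortCount : length fs ≡ length (shortPairs (blockAt o F))
      longMet    : LongMet (blockAt o F) (λ i → o + offset i) fl
      shortMet   : ShortMet (blockAt o F) (λ i → o + offset i) fs

  fromLayout : ∀ {o F s e fl fs} → Layout o F s e fl fs → LocalSchedule o F s e fl fs
  fromLayout {o} {F} {s} {e} {fl} {fs} Λ = record
    { schedule = S
    ; window   = subst (delay s o ≤_) (sym (hi≡ e)) (shift-lower s o (runs-bounded _ _ runs))
    ; starts   = λ i → shift-lower s o (proj₁ (window-of i))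
    ; ends     = λ i → subst (o + offset i + size i ≤_) (sym (hi≡ e))
                             (shift-≤ o (proj₂ (window-of i)))
    }
    where
    open Layout Λ using (L; length≡L; offset; complete; runs; placed)
    size : AllIdx (blockAt o F) → ℕ
    size = len ∘ allTask p q (blockAt o F)
    window-of : ∀ i → delay s 0 ≤ offset i × offset i + size i ≤ delay e L
    window-of i = runs-window _ _ runs (complete i)
    hi≡ : ∀ b → delay b (o + blockLen p q F) ≡ o + delay b L
    hi≡ b = trans (cong (delay b ∘ (o +_)) length≡L) (delay-+ b o L)
    disjoint : ∀ i j → i ≢ j → Disjoint (o + offset i) (size i) (o + offset j) (size j)
    disjoint i j ne = Sum.map (shift-≤ o) (shift-≤ o)
                              (runs-disjoint _ _ runs (complete i) (complete j) ne)
    S : Scheduled (blockAt o F) fl fs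
    S = record
      { start = λ i → o + offset i ; feasible = placed , disjoint
      ; longCount = Layout.longCount Λ ; shortCount = Layout.shortCount Λ
      ; longMet = Layout.longMet Λ ; shortMet = Layout.shortMet Λ }

  -- The state in which the block after a block left in state e is entered;
  -- a separator (sep = true) absorbs a late finish.
  resume : Bool → Bool → Bool
  resume sep e = if sep then false else e

  resume-≤ : ∀ e x sep → delay e x ≤ delay (resume sep e) (x + gap sep)
  resume-≤ e x true  = ≤-trans (delay-≤ e x) (+-monoʳ-≤ x (m≤n+m 1 q))
  resume-≤ e x false = ≤-reflexive (cong (delay e) (sym (+-identityʳ x)))

  data Chain : Bool → List (Block × Bool) → Bool → List Bool → List Bool → Set where
    []   : ∀ {e} → Chain e [] e [] []
    next : ∀ {e s e₁ e′ F sep xs fl fs fl′ fs′} → e Bool.≤ s →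
           (∀ o → LocalSchedule o F s e₁ fl fs) → Chain (resume sep e₁) xs e′ fl′ fs′ →
           Chain e ((F , sep) ∷ xs) e′ (fl ++ fl′) (fs ++ fs′)

  infixr 5 _++ᶜ_
  _++ᶜ_ : ∀ {e e₁ e₂ xs ys fl fs fl′ fs′} →
          Chain e xs e₁ fl fs → Chain e₁ ys e₂ fl′ fs′ →
          Chain e (xs ++ ys) e₂ (fl ++ fl′) (fs ++ fs′)
  [] ++ᶜ chain = chain
  _++ᶜ_ {fl′ = fl′} {fs′} (next {fl = fl} {fs} {fl₁} {fs₁} e≤s local rest) chain =
    subst₂ (Chain _ _ _) (sym (++-assoc fl fl₁ fl′)) (sym (++-assoc fs fs₁ fs′))
           (next e≤s local (rest ++ᶜ chain))

  markLast-chain : ∀ {J : Set} {e s x fl fs} (F : Block) (G : J → Block) (gl gs : J → Bool) →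
                   e Bool.≤ s → (∀ o → LocalSchedule o F s x fl fs) →
                   (∀ j o → LocalSchedule o (G j) x x (gl j ∷ []) (gs j ∷ [])) →
                   ∀ js → Chain e (markLast (F ∷ map G js)) false
                                (fl ++ map gl js) (fs ++ map gs js)
  markLast-chain F G gl gs e≤s first later []       = next e≤s first []
  markLast-chain F G gl gs e≤s first later (j ∷ js) =
    next e≤s first (markLast-chain (G j) G gl gs b≤b (later j) later js)

  schedule : ∀ {e xs e′ fl fs} → Chain e xs e′ fl fs → ∀ o →
             Σ[ S ∈ Scheduled (buildFrom p q o xs) fl fs ] StartsAfter S (delay e o)
  schedule [] o = nothing-scheduled , no-index
  schedule {e} (next {s = s} {e₁} {F = F} {sep} {xs} {fl} {fs} {fl′} {fs′} e≤s local rest) o =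
    whole , whole-starts
    where
    B : LocalSchedule o F s e₁ fl fs
    B = local o
    x : ℕ
    x = o + blockLen p q F
    Sep : Scheduled (separatorAt x sep) [] []
    Sep = proj₁ (separator x sep)
    R : Scheduled (buildFrom p q (x + gap sep) xs) fl′ fs′
    R = proj₁ (schedule rest (x + gap sep))
    R-starts : StartsAfter R (delay (resume sep e₁) (x + gap sep))
    R-starts = proj₂ (schedule rest (x + gap sep))
    tail : Scheduled (separatorAt x sep ⊕ buildFrom p q (x + gap sep) xs) fl′ fs′
    tail = append Sep R (x + gap sep) (proj₂ (proj₂ (separator x sep)))
                  (λ i → ≤-trans (≤-delay _ _) (R-starts i))
    tail-starts : StartsAfter tail (delay e₁ x)
    tail-starts = append-startsAfter Sep R
      (λ i → ≤-trans (delay-≤ e₁ x) (proj₁ (proj₂ (separator x sep)) i))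
      (λ i → ≤-trans (resume-≤ e₁ x sep) (R-starts i))
    whole : Scheduled (buildFrom p q o ((F , sep) ∷ xs)) (fl ++ fl′) (fs ++ fs′)
    whole = append (LocalSchedule.schedule B) tail (delay e₁ x) (LocalSchedule.ends B) tail-starts
    whole-starts : StartsAfter whole (delay e o)
    whole-starts = append-startsAfter (LocalSchedule.schedule B) tail
      (λ i → ≤-trans (delay-mono o e≤s) (LocalSchedule.starts B i))
      (λ i → ≤-trans (≤-trans (delay-mono o e≤s) (LocalSchedule.window B)) (tail-starts i))

-- Here q = a + 2 and p = q + 1 + b, which covers all p > q > 1; both are
-- inlined so that the ring solver, run on the variables a and b, sees
-- through them.
module Reduction (a b : ℕ) where

  q : ℕ
  q = suc (suc a)
  {-# INLINE q #-}

  p : ℕ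
  p = suc q + b
  {-# INLINE p #-}

  open Scheduling p q
  open ≡-Reasoning

  vars : List ℕ
  vars = a ∷ b ∷ []

  -- A long dummy block: its long pending task runs on time (and misses d′ = p − 1).
  longDummyAt : ∀ o → LocalSchedule o (longDummy p q) false false (false ∷ []) []
  longDummyAt o = fromLayout record
    { L = p ; length≡L = +-identityʳ p ; offset = λ _ → 0
    ; order = longP ∷ [] ; complete = tasks-L (here refl)
    ; runs = z≤n ▸ done ≤-refl
    ; placed = tasks-L (placedPending o p p 0 ≤-refl)
    ; longCount = refl ; shortCount = refl ; longMet = λ { fzero () } ; shortMet = λ () }

  shortDummyAt : ∀ o → LocalSchedule o (shortDummy p q) false false [] (false ∷ [])
  shortDummyAt o = fromLayout record
    { L = q ; length≡L = refl ; offset = λ _ → 0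
    ; order = shortP ∷ [] ; complete = tasks-S (here refl)
    ; runs = z≤n ▸ done ≤-refl
    ; placed = tasks-S (placedPending o q q 0 ≤-refl)
    ; longCount = refl ; shortCount = refl ; longMet = λ () ; shortMet = λ { fzero () } }

  -- On time (u true): B, A, then the long
  -- pending task, which finishes at p + 2q and misses d′ = p + q + 1.  Late
  -- (u false): A, the long pending task, which now meets d′, then B.
  vplusAt : ∀ u o → LocalSchedule o (Vplus p q) (not u) (not u) (not u ∷ []) []
  vplusAt true o = fromLayout record
    { L = q + q + p
    ; length≡L = begin
        blockLen p q (Vplus p q) ≡⟨⟩ q + (q + 0) + p + 0 ≡⟨ solve vars ⟩ q + q + p ∎
    ; offset = tasks-V⁺ q 0 (q + q)
    ; order = auxB ∷ auxA ∷ longP ∷ []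
    ; complete = tasks-V⁺ (there (here refl)) (here refl) (there (there (here refl)))
    ; runs = z≤n ▸ ≤-refl ▸ ≤-refl ▸ done ≤-refl
    ; placed = tasks-V⁺ (placedAux o 1 (2 * q) q q (slack (suc a) (solve vars)) (slack 0 (solve vars)))
                        (placedAux o 0 (p + 2 * q + 1) q 0 z≤n (slack (p + q + 1) (solve vars)))
                        (placedPending o (p + 2 * q) p (q + q) (slack 0 (solve vars)))
    ; longCount = refl ; shortCount = refl ; longMet = λ { fzero () } ; shortMet = λ () }
  vplusAt false o = fromLayout record
    { L = q + p + q
    ; length≡L = begin
        blockLen p q (Vplus p q) ≡⟨⟩ q + (q + 0) + p + 0 ≡⟨ solve vars ⟩ q + p + q ∎
    ; offset = tasks-V⁺ 1 (1 + q + p) (1 + q)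
    ; order = auxA ∷ longP ∷ auxB ∷ []
    ; complete = tasks-V⁺ (here refl) (there (there (here refl))) (there (here refl))
    ; runs = ≤-refl ▸ ≤-refl ▸ ≤-refl ▸ done ≤-refl
    ; placed = tasks-V⁺ (placedAux o 1 (2 * q) q 1 ≤-refl (slack (suc a) (solve vars)))
                        (placedAux o 0 (p + 2 * q + 1) q (1 + q + p) z≤n (slack 0 (solve vars)))
                        (placedPending o (p + 2 * q) p (1 + q) (slack (suc a) (solve vars)))
    ; longCount = refl ; shortCount = refl
    ; longMet = λ { fzero _ → atOffset o (p + q + 1) p (1 + q) (slack 0 (solve vars)) }
    ; shortMet = λ () }

  -- V⁻ for a variable with value u.  u true: the short pending task first,
  -- meeting d′ = q, then A from time q + 1 and B, so the block ends late.
  -- u false: B, A, then the short pending task, which misses d′; on time.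
  vminusAt : ∀ u o → LocalSchedule o (Vminus p q) false u [] (u ∷ [])
  vminusAt true o = fromLayout record
    { L = q + q + p
    ; length≡L = begin
        blockLen p q (Vminus p q) ≡⟨⟩ q + (p + 0) + 0 + q ≡⟨ solve vars ⟩ q + q + p ∎
    ; offset = tasks-V⁻ (suc q) (suc q + q) 0
    ; order = shortP ∷ auxA ∷ auxB ∷ []
    ; complete = tasks-V⁻ (there (here refl)) (there (there (here refl))) (here refl)
    ; runs = z≤n ▸ n≤1+n q ▸ ≤-refl ▸ done ≤-refl
    ; placed = tasks-V⁻ (placedAux o (q + 1) (p + q) q (suc q) (slack 0 (solve vars))
                                   (slack b (solve vars)))
                        (placedAux o 0 (p + 2 * q + 1) p (suc q + q) z≤n (slack 0 (solve vars)))
                        (placedPending o (p + 2 * q) q 0 (slack (p + q) (solve vars)))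
    ; longCount = refl ; shortCount = refl ; longMet = λ ()
    ; shortMet = λ { fzero _ → atOffset o q q 0 ≤-refl } }
  vminusAt false o = fromLayout record
    { L = p + q + q
    ; length≡L = begin
        blockLen p q (Vminus p q) ≡⟨⟩ q + (p + 0) + 0 + q ≡⟨ solve vars ⟩ p + q + q ∎
    ; offset = tasks-V⁻ p 0 (p + q)
    ; order = auxB ∷ auxA ∷ shortP ∷ []
    ; complete = tasks-V⁻ (there (here refl)) (here refl) (there (there (here refl)))
    ; runs = z≤n ▸ ≤-refl ▸ ≤-refl ▸ done ≤-refl
    ; placed = tasks-V⁻ (placedAux o (q + 1) (p + q) q p (slack b (solve vars)) (slack 0 (solve vars)))
                        (placedAux o 0 (p + 2 * q + 1) p 0 z≤n (slack (2 * q + 1) (solve vars)))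
                        (placedPending o (p + 2 * q) q (p + q) (slack 0 (solve vars)))
    ; longCount = refl ; shortCount = refl ; longMet = λ () ; shortMet = λ { fzero () } }

  clauseLike : ℕ → Block
  clauseLike D′ = block [] (just (D′ , p + q + 1)) (just (D′ , p + q + 1))

  longFirst : ∀ D′ s o {fl fs} →
              (fl ≡ true → delay s 0 + p ≤ D′) → (fs ≡ true → delay s 0 + p + q ≤ D′) →
              LocalSchedule o (clauseLike D′) s s (fl ∷ []) (fs ∷ [])
  longFirst D′ s o long-meets short-meets = fromLayout record
    { L = p + q ; length≡L = refl
    ; offset = tasks-C (delay s 0) (delay s 0 + p)
    ; order = longP ∷ shortP ∷ []
    ; complete = tasks-C (here refl) (there (here refl))
    ; runs = ≤-refl ▸ ≤-refl ▸
             done (≤-reflexive (trans (+-assoc (delay s 0) p q) (delay-start s (p + q))))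
    ; placed = tasks-C (placedPending o (p + q + 1) p (delay s 0) long-fits)
                       (placedPending o (p + q + 1) q (delay s 0 + p) short-fits)
    ; longCount = refl ; shortCount = refl
    ; longMet = λ { fzero flag → atOffset o D′ p (delay s 0) (long-meets flag) }
    ; shortMet = λ { fzero flag → atOffset o D′ q (delay s 0 + p) (short-meets flag) } }
    where
    long-fits : delay s 0 + p ≤ p + q + 1
    long-fits = ≤-trans (delay-start-≤ s p) (+-monoˡ-≤ 1 (m≤m+n p q))
    short-fits : delay s 0 + p + q ≤ p + q + 1
    short-fits = ≤-trans (≤-reflexive (+-assoc (delay s 0) p q)) (delay-start-≤ s (p + q))

  shortFirst : ∀ D′ s o {fl fs} →
               (fl ≡ true → delay s 0 + q + p ≤ D′) → (fs ≡ true → delay s 0 + q ≤ D′) →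
               LocalSchedule o (clauseLike D′) s s (fl ∷ []) (fs ∷ [])
  shortFirst D′ s o long-meets short-meets = fromLayout record
    { L = q + p ; length≡L = +-comm p q
    ; offset = tasks-C (delay s 0 + q) (delay s 0)
    ; order = shortP ∷ longP ∷ []
    ; complete = tasks-C (there (here refl)) (here refl)
    ; runs = ≤-refl ▸ ≤-refl ▸
             done (≤-reflexive (trans (+-assoc (delay s 0) q p) (delay-start s (q + p))))
    ; placed = tasks-C (placedPending o (p + q + 1) p (delay s 0 + q) long-fits)
                       (placedPending o (p + q + 1) q (delay s 0) short-fits)
    ; longCount = refl ; shortCount = refl
    ; longMet = λ { fzero flag → atOffset o D′ p (delay s 0 + q) (long-meets flag) }
    ; shortMet = λ { fzero flag → atOffset o D′ q (delay s 0) (short-meets flag) } }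
    where
    long-fits : delay s 0 + q + p ≤ p + q + 1
    long-fits = ≤-trans (≤-reflexive (trans (+-assoc (delay s 0) q p)
                                            (cong (delay s 0 +_) (+-comm q p))))
                        (delay-start-≤ s (p + q))
    short-fits : delay s 0 + q ≤ p + q + 1
    short-fits = ≤-trans (delay-start-≤ s q) (+-monoˡ-≤ 1 (m≤n+m q p))

  -- Started by time 1, the long task finishes by p + q − 1 = q + b + q
  -- since q ≥ 2, and the short task does since p ≥ 2.
  long-early : ∀ s → delay s 0 + p ≤ p + q ∸ 1
  long-early false = slack {p} {q + b + q} (suc a) (solve vars)
  long-early true  = slack {suc p} {q + b + q} a (solve vars)

  short-early : ∀ s → delay s 0 + q ≤ p + q ∸ 1
  short-early false = slack {q} {q + b + q} (q + b) (solve vars)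
  short-early true  = slack {suc q} {q + b + q} (suc (a + b)) (solve vars)

  clauseAt : ∀ active s c o → LocalSchedule o (if active then Cactive p q else Cinactive p q) s s
                                              (c ∷ []) ((not c ∨ (active ∧ not s)) ∷ [])
  clauseAt true  s true  o =
    longFirst (p + q) s o (λ _ → ≤-trans (long-early s) (m∸n≤m (p + q) 1)) (on-time s)
    where
    on-time : ∀ s → not s ≡ true → delay s 0 + p + q ≤ p + q
    on-time false _ = ≤-refl
  clauseAt false s true  o = longFirst (p + q ∸ 1) s o (λ _ → long-early s) (λ ())
  clauseAt true  s false o =
    shortFirst (p + q) s o (λ ()) (λ _ → ≤-trans (short-early s) (m∸n≤m (p + q) 1))
  clauseAt false s false o = shortFirst (p + q ∸ 1) s o (λ ()) (λ _ → short-early s)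

  module Plan {n m : ℕ} (φ : CNF n m) (α : Fin n → Bool) where
    open DecMembership (_≟L_ {n}) using (_∈?_)

    clauses : List (Fin m)
    clauses = allFin m

    clauses-length : length clauses ≡ m
    clauses-length = length-tabulate id

    -- α falsifies ℓ; the blocks of ℓ are then scheduled late.
    falsified : Literal n → Bool
    falsified (i , true)  = not (α i)
    falsified (i , false) = α i

    hits : Literal n → Fin m → Bool
    hits ℓ j = ⌊ ℓ ∈? φ j ⌋ ∧ not (falsified ℓ)

    -- A coverage records the clauses satisfied by the literals seen so far.
    Coverage : Set
    Coverage = Fin m → Bool

    _⊳_ : Coverage → Literal n → Coverage
    (c ⊳ ℓ) j = c j ∨ hits ℓ j

    _⊳var_ : Coverage → Fin n → Coverage
    c ⊳var i = (c ⊳ (i , true)) ⊳ (i , false)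

    -- In the sequence of ℓ (reached with coverage c) the clause block of
    -- C_j puts the long task first iff C_j is covered after ℓ; its short
    -- flag is then set iff the short task goes first or ℓ itself covers C_j.
    shortFlag : Coverage → Literal n → Fin m → Bool
    shortFlag c ℓ j = not ((c ⊳ ℓ) j) ∨ hits ℓ j

    -- The flag of a literal block: V⁺ reports its long pending task, V⁻
    -- its short one; both are set iff the literal is false.
    literalLong : Literal n → List Bool
    literalLong (i , true)  = not (α i) ∷ []
    literalLong (i , false) = []

    literalShort : Literal n → List Bool
    literalShort (i , true)  = []
    literalShort (i , false) = α i ∷ []

    literalChain : ∀ c ℓ → Chain false (literalSeq p q φ ℓ) false
                                 (literalLong ℓ ++ map (c ⊳ ℓ) clauses)
                                 (literalShort ℓ ++ map (shortFlag c ℓ) clauses)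
    literalChain c (i , true)  = markLast-chain (Vplus p q) (clauseBlock p q φ (i , true)) _ _
      (≤-minimum _) (vplusAt (α i)) (λ j → clauseAt (⌊ (i , true) ∈? φ j ⌋) _ _) clauses
    literalChain c (i , false) = markLast-chain (Vminus p q) (clauseBlock p q φ (i , false)) _ _
      b≤b (vminusAt (α i)) (λ j → clauseAt (⌊ (i , false) ∈? φ j ⌋) _ _) clauses

    longFlags : Coverage → List (Fin n) → List Bool
    longFlags c []       = []
    longFlags c (i ∷ is) =
      ((not (α i) ∷ map (c ⊳ (i , true)) clauses) ++ map (c ⊳var i) clauses)
      ++ longFlags (c ⊳var i) is

    shortFlags : Coverage → List (Fin n) → List Bool
    shortFlags c []       = []
    shortFlags c (i ∷ is) = (map (shortFlag c (i , true)) clauses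
                             ++ (α i ∷ map (shortFlag (c ⊳ (i , true)) (i , false)) clauses))
                            ++ shortFlags (c ⊳var i) is

    variablesChain : ∀ c is →
      Chain false (concatMap (λ i → literalSeq p q φ (i , true) ++ literalSeq p q φ (i , false)) is)
            false (longFlags c is) (shortFlags c is)
    variablesChain c []       = []
    variablesChain c (i ∷ is) =
      (literalChain c (i , true) ++ᶜ literalChain (c ⊳ (i , true)) (i , false)) ++ᶜ
      variablesChain (c ⊳var i) is

    longDummies : ∀ k →
      Chain false (replicate k (longDummy p q , false)) false (replicate k false) []
    longDummies zero    = []
    longDummies (suc k) = next b≤b longDummyAt (longDummies k)

    shortDummies : ∀ k →
      Chain false (replicate k (shortDummy p q , false)) false [] (replicate k false)
    shortDummies zero    = []
    shortDummies (suc k) = next b≤b shortDummyAt (shortDummies k)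

    none : Coverage
    none _ = false

    fullChain : Chain false (blockSequence p q φ) false
                      (replicate m false ++ (longFlags none (allFin n) ++ []))
                      (shortFlags none (allFin n) ++ replicate m false)
    fullChain = longDummies m ++ᶜ variablesChain none (allFin n) ++ᶜ shortDummies m

    -- The long flag of a clause block reached with coverage c covers the
    -- short flag of the next clause block of the same clause:
    -- x ∨ ¬(x ∨ h) ∨ h holds for all x, h.
    clauseCovers : ∀ c ℓ → Pointwise Covers (map c clauses) (map (shortFlag c ℓ) clauses)
    clauseCovers c ℓ =
      Pointwise.map⁺ c (shortFlag c ℓ) (Pointwise.refl λ {j} → covered (c j) (hits ℓ j))
      where
      covered : ∀ x h → Covers x (not (x ∨ h) ∨ h)
      covered true  h     = refl
      covered false true  = refl
      covered false false = refl

    -- At the end, the long flags of the last clause blocks are those of a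
    -- complete coverage and need no short partner.
    completeCovers : ∀ {c : Coverage} → (∀ j → c j ≡ true) → (js : List (Fin m)) →
                     Pointwise Covers (map c js) (replicate (length js) false)
    completeCovers complete []       = []
    completeCovers complete (j ∷ js) =
      trans (∨-identityʳ _) (complete j) ∷ completeCovers complete js

    -- The flags of the variables is, reached with coverage c, cover each
    -- other once the long flags are preceded by c (the long flags of the
    -- clause blocks before them) and the short flags are followed by those
    -- of the short dummies, provided every clause is eventually covered.
    -- Each pair is a literal block pair (¬α i , α i) or a clause pair.
    flagsCover : ∀ c is → (∀ j → foldl _⊳var_ c is j ≡ true) →
                 Pointwise Covers (map c clauses ++ longFlags c is)
                                  (shortFlags c is ++ replicate m false)
    flagsCover c [] complete =
      subst₂ (Pointwise Covers) (sym (++-identityʳ (map c clauses)))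
             (cong (λ k → replicate k false) clauses-length) (completeCovers complete clauses)
    flagsCover c (i ∷ is) complete = subst₂ (Pointwise Covers) (sym long≡) (sym short≡)
      (Pointwise.++⁺ (clauseCovers c (i , true))
        (∨-inverseˡ (α i) ∷ Pointwise.++⁺ (clauseCovers (c ⊳ (i , true)) (i , false))
                                          (flagsCover (c ⊳var i) is complete)))
      where
      long≡ : map c clauses ++ longFlags c (i ∷ is)
              ≡ map c clauses ++ (not (α i) ∷ (map (c ⊳ (i , true)) clauses
                                               ++ (map (c ⊳var i) clauses ++ longFlags (c ⊳var i) is)))
      long≡ = cong (map c clauses ++_) (++-assoc (not (α i) ∷ map (c ⊳ (i , true)) clauses) _ _)
      short≡ : shortFlags c (i ∷ is) ++ replicate m false
               ≡ map (shortFlag c (i , true)) clauses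
                 ++ (α i ∷ (map (shortFlag (c ⊳ (i , true)) (i , false)) clauses
                            ++ (shortFlags (c ⊳var i) is ++ replicate m false)))
      short≡ = trans (++-assoc (map (shortFlag c (i , true)) clauses ++ _) _ _)
                     (++-assoc (map (shortFlag c (i , true)) clauses) _ _)

    ⊳var-keeps : ∀ c i j → c j ≡ true → (c ⊳var i) j ≡ true
    ⊳var-keeps c i j covered rewrite covered = refl

    ⊳var-hits : ∀ c i b j → hits (i , b) j ≡ true → (c ⊳var i) j ≡ true
    ⊳var-hits c i true  j hit rewrite hit | ∨-zeroʳ (c j) = refl
    ⊳var-hits c i false j hit rewrite hit = ∨-zeroʳ _

    foldl-keeps : ∀ c is j → c j ≡ true → foldl _⊳var_ c is j ≡ true
    foldl-keeps c []       j covered = covered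
    foldl-keeps c (i ∷ is) j covered = foldl-keeps (c ⊳var i) is j (⊳var-keeps c i j covered)

    foldl-hits : ∀ c {i is} b j → i ∈ is → hits (i , b) j ≡ true → foldl _⊳var_ c is j ≡ true
    foldl-hits c {is = i ∷ is} b j (here refl) hit =
      foldl-keeps (c ⊳var i) is j (⊳var-hits c i b j hit)
    foldl-hits c {is = i ∷ is} b j (there i∈) hit = foldl-hits (c ⊳var i) b j i∈ hit

    satisfied-covers : Satisfies α φ → ∀ j → foldl _⊳var_ none (allFin n) j ≡ true
    satisfied-covers sat j with find (sat j)
    ... | (i , b) , ℓ∈C , α-sat = foldl-hits none b j (∈-allFin i) hit
      where
      true-literal : ∀ {b} → α i ≡ b → not (falsified (i , b)) ≡ true
      true-literal {true}  αi≡true  rewrite αi≡true  = refl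
      true-literal {false} αi≡false rewrite αi≡false = refl
      hit : hits (i , b) j ≡ true
      hit with (i , b) ∈? φ j
      ... | yes _   = true-literal α-sat
      ... | no  ℓ∉C = ⊥-elim (ℓ∉C ℓ∈C)

    soundness : Satisfies α φ → YesInstance p q (constructAux p q φ)
    soundness sat = yes-instance (proj₁ (schedule fullChain 0))
      (subst (λ fl → Pointwise Covers fl (shortFlags none (allFin n) ++ replicate m false))
             initial (flagsCover none (allFin n) (satisfied-covers sat)))
      where
      initial : map none clauses ++ longFlags none (allFin n)
                ≡ replicate m false ++ (longFlags none (allFin n) ++ [])
      initial = cong₂ _++_ (trans (map-const clauses) (cong (λ k → replicate k false) clauses-length))
                           (sym (++-identityʳ _))
        where
        map-const : (js : List (Fin m)) → map none js ≡ replicate (length js) false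
        map-const []       = refl
        map-const (j ∷ js) = cong (false ∷_) (map-const js)

mainTheorem7 : (p q : ℕ) → 1 < q → q < p → (n m : ℕ) → (φ : CNF n m) →
  Satisfiable φ → YesInstance p q (constructAux p q φ)
mainTheorem7 p (suc (suc a)) (s≤s (s≤s z≤n)) q<p n m φ (α , sat) with m≤n⇒∃[o]m+o≡n q<p
... | b , refl = Reduction.Plan.soundness a b φ α sat
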